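{- Let $\widetilde{\Upsilon}$ be the transformed alignment of $m$ similar strings as described in the context, with suffix array of alignment $SAA[1..n]$, arrays $F$, $L$, set of pairs $\mathcal{L}$ and LF-mapping $LF$. If a pair $(\sigma,i)\in\mathcal{L}$ is of (m:1)-type, then every character in $L[i]$ equals $\sigma$, i.e. $L[i]=\{\sigma\}$.
   Context: Setting. Let $\Sigma$ be a totally ordered alphabet and let $S^1,\dots,S^m$ be strings with $S^j=\alpha_1\Delta^j_1\alpha_2\Delta^j_2\cdots\alpha_r\Delta^j_r\alpha_{r+1}$ for $1\le j\le m$, where each $\alpha_i$ ($1\le i\le r+1$) is a nonempty common substring (the same in all strings) and each $\Delta^j_i$ ($1\le i\le r$) is a (possibly empty) non-common substring. $\alpha_1$ starts with the special symbol $\$$ and $\alpha_{r+1}$ ends with the special symbol $\#$, and $\$,\#$ occur nowhere else in any $S^j$. For $1\le i\le r$, $\tilde{\alpha}^{+}_i$ is the shortest suffix of $\alpha_i$ that occurs exactly once in each string $S^j$; $\tilde{\alpha}^{+}_{r+1}$ is empty. Standing assumption: for $2\le i\le r+1$, $\tilde{\alpha}^{+}_i$ is strictly shorter than $\alpha_i$. Let $\tilde{\alpha}^{\diamond}_i$ be the prefix of $\alpha_i$ with $\alpha_i=\tilde{\alpha}^{\diamond}_i\tilde{\alpha}^{+}_i$. Transformed alignment $\widetilde{\Upsilon}$: a grid with $m$ rows and columns $1,\dots,N$, consisting consecutively of: a cs-region of $|\tilde{\alpha}^{\diamond}_1|$ columns in which every row contains $\tilde{\alpha}^{\diamond}_1$;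 then a ps-region of $w_1=\max_j|\tilde{\alpha}^{+}_1\Delta^j_1|$ columns in which row $j$ contains $\tilde{\alpha}^{+}_1\Delta^j_1$ right-justified (preceded by empty cells/gaps); then the cs-region for $\tilde{\alpha}^{\diamond}_2$, the ps-region for $\tilde{\alpha}^{+}_2\Delta_2$, etc., ending with the cs-region for $\tilde{\alpha}^{\diamond}_{r+1}$. $\widetilde{S}^j[q]$ is the cell of row $j$ at column $q$ (a character or empty). For nonempty $\widetilde{S}^j[q]$, the suffix $(j,q)$ is the string of nonempty cells of row $j$ at columns $\ge q$; its preceding character is $\widetilde{S}^j[q']$ with $q'$ the largest column $<q$ where row $j$ is nonempty, or cyclically the final $\#$ at column $q'=N$ if $q=1$. a-suffixes: if $q$ is in a cs-region, all suffixes $(j,q)$, $1\le j\le m$, form one a-suffix. If $q$ is in the ps-region of $\tilde{\alpha}^{+}_i\Delta_i$, let $\delta^j_i$ be the content of row $j$ from column $q$ to the end of that ps-region; the suffixes $(j,q)$ with $\widetilde{S}^j[q]$ nonempty are partitioned so that $(j_1,q),(j_2,q)$ are in the same class iff $\delta^{j_1}_i=\delta^{j_2}_i$; each class is an a-suffix. Suffixes of one a-suffix are consecutive in the lexicographic order of all suffixes; $SAA[1..n]$ lists all a-suffixes in the induced lexicographic order. $F[i]$ is the (single) first character of suffixes in $SAA[i]$; $L[i]$ is the set of preceding characters of the suffixes in $SAA[i]$. $\mathcal{L}=\{(\sigma,i):\sigma\in L[i]\}$. For $(\sigma,i)\in\mathcal{L}$, $LF(\sigma,i)$ is the index $k$ such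 that $SAA[k]$ contains the suffix $(j,q')$, where $(j,q)$ is a suffix in $SAA[i]$ whose preceding character $\widetilde{S}^j[q']$ equals $\sigma$ (this $k$ does not depend on the choice of such $j$). A pair $(\sigma,i)\in\mathcal{L}$ is of (m:1)-type if there is another pair $(\sigma,i')\in\mathcal{L}$, $i'\ne i$, with $LF(\sigma,i)=LF(\sigma,i')$; otherwise it is of (1:1)-type. -}

module Defs where

open import Data.Nat using (ℕ; zero; suc; _∸_; _≤_; _<_; _⊔_)
open import Data.Fin using (Fin; zero; suc; toℕ; inject₁; fromℕ; _≟_)
open import Data.List using (List; []; _∷_; _++_; length; take; drop; replicate; map; foldr; allFin)
open import Data.Maybe using (Maybe; just; nothing; fromMaybe)
open import Data.Product using (Σ; ∃; _×_; _,_)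
open import Data.Unit using (⊤)
open import Data.Empty using (⊥)
open import Relation.Nullary using (¬_; yes; no)
open import Relation.Binary.PropositionalEquality using (_≡_; _≢_)

-- Positions/columns are 0-indexed throughout.
at : {A : Set} → List A → ℕ → Maybe A
at []       _       = nothing
at (x ∷ xs) zero    = just x
at (x ∷ xs) (suc n) = at xs n

interleave : {A : Set} {r : ℕ} → (Fin (suc r) → List A) → (Fin r → List A) → List A
interleave {r = zero}  a d = a zero
interleave {r = suc r} a d = a zero ++ d zero ++ interleave (λ i → a (suc i)) (λ i → d (suc i))

extend0 : {r : ℕ} → (Fin r → ℕ) → Fin (suc r) → ℕ
extend0 {zero}  f zero    = 0
extend0 {suc r} f zero    = f zero
extend0 {suc r} f (suc i) = extend0 (λ k → f (suc k)) i

OccursAt : {A : Set} → List A → List A → ℕ → Set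
OccursAt u s p = take (length u) (drop p s) ≡ u

OccursOnce : {A : Set} → List A → List A → Set
OccursOnce u s = Σ ℕ λ p → OccursAt u s p × (∀ p' → OccursAt u s p' → p' ≡ p)

suffixOfLen : {A : Set} → ℕ → List A → List A
suffixOfLen k u = drop (length u ∸ k) u

str : {C : Set} {m r : ℕ} → (Fin (suc r) → List C) → (Fin m → Fin r → List C) → Fin m → List C
str α Δ j = interleave α (Δ j)

-- Paper index i (1..r+1) is Fin index i-1.
-- ℓ i is |α̃⁺_i| for paper indices 1..r, given by its defining specification
-- (shortest suffix of α_i occurring exactly once in every S^j).
record Setting : Set₁ where
  field
    C          : Set
    dollar     : C
    hash       : C
    dollar≢hash : dollar ≢ hash
    m          : ℕ
    r          : ℕ
    α          : Fin (suc r) → List C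
    Δ          : Fin m → Fin r → List C
    α-nonempty : ∀ i → α i ≢ []
    α-first    : ∃ λ t → α zero ≡ dollar ∷ t
    α-last     : ∃ λ t → α (fromℕ r) ≡ t ++ (hash ∷ [])
    dollar-only : ∀ j p → at (str α Δ j) p ≡ just dollar → p ≡ 0
    hash-only   : ∀ j p → at (str α Δ j) p ≡ just hash → suc p ≡ length (str α Δ j)
    ℓ          : Fin r → ℕ
    ℓ-le       : ∀ i → ℓ i ≤ length (α (inject₁ i))
    ℓ-once     : ∀ i j → OccursOnce (suffixOfLen (ℓ i) (α (inject₁ i))) (str α Δ j)
    ℓ-min      : ∀ i k → k < ℓ i →
                 ¬ (∀ j → OccursOnce (suffixOfLen k (α (inject₁ i))) (str α Δ j))
    -- standing assumption for paper indices 2..r (index r+1 is automatic: α̃⁺ empty, α nonempty)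
    standing   : ∀ i → 1 ≤ toℕ i → ℓ i < length (α (inject₁ i))

data Tag (r : ℕ) : Set where
  cs : Tag r
  ps : Fin r → Tag r

module Alignment (I : Setting) where
  open Setting I public

  ℓ⁺ : Fin (suc r) → ℕ
  ℓ⁺ = extend0 ℓ

  αdia : Fin (suc r) → List C
  αdia i = take (length (α i) ∸ ℓ⁺ i) (α i)

  αplus : Fin (suc r) → List C
  αplus i = drop (length (α i) ∸ ℓ⁺ i) (α i)

  psContent : Fin m → Fin r → List C
  psContent j i = αplus (inject₁ i) ++ Δ j i

  width : Fin r → ℕ
  width i = foldr _⊔_ 0 (map (λ j → length (psContent j i)) (allFin m))

  layout : List (Tag r)
  layout = interleave (λ i → replicate (length (αdia i)) cs) (λ i → replicate (width i) (ps i))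

  N : ℕ
  N = length layout

  -- row j of the transformed alignment (nothing = empty cell)
  row : Fin m → List (Maybe C)
  row j = interleave (λ i → map just (αdia i))
                     (λ i → replicate (width i ∸ length (psContent j i)) nothing ++ map just (psContent j i))

  cell : Fin m → ℕ → Maybe C
  cell j q with at (row j) q
  ... | just x  = x
  ... | nothing = nothing

  IsSuffix : Fin m → ℕ → Set
  IsSuffix j q = ∃ λ c → cell j q ≡ just c

  lastNonempty : Fin m → ℕ → Maybe ℕ
  lastNonempty j zero = nothing
  lastNonempty j (suc q) with cell j q
  ... | just _  = just q
  ... | nothing = lastNonempty j q

  -- column of the preceding character (cyclically the last column N-1, holding #)
  prev : Fin m → ℕ → ℕ
  prev j q = fromMaybe (N ∸ 1) (lastNonempty j q)

  precChar : Fin m → ℕ → Maybe C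
  precChar j q = cell j (prev j q)

  regionRest : Fin r → List (Tag r) → List (Maybe C) → List (Maybe C)
  regionRest i (ps k ∷ ts) (c ∷ cs') with k ≟ i
  ... | yes _ = c ∷ regionRest i ts cs'
  ... | no _  = []
  regionRest i _ _ = []

  -- δ^j_i: content of row j from column q to the end of ps-region i
  δ : Fin m → ℕ → Fin r → List (Maybe C)
  δ j q i = regionRest i (drop q layout) (drop q (row j))

  SameClassAt : ℕ → Fin m → Fin m → Set
  SameClassAt q j₁ j₂ with at layout q
  ... | just cs     = ⊤
  ... | just (ps i) = δ j₁ q i ≡ δ j₂ q i
  ... | nothing     = ⊥

  -- suffixes (j₁,q₁), (j₂,q₂) belong to the same a-suffix (same SAA entry)
  SameA : Fin m × ℕ → Fin m × ℕ → Set
  SameA (j₁ , q₁) (j₂ , q₂) = q₁ ≡ q₂ × SameClassAt q₁ j₁ j₂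

module Submission where

-- In the encoding, (j₁,q₁) and (j₂,q₂) lie in different a-suffixes while their
-- predecessors lie in the same one; we show that every suffix (j,q₁) in the a-suffix of
-- (j₁,q₁) has the same preceding character as (j₁,q₁).  Let q₁ = c + 1.
--   * q₁ = 0, or c is a cs-column: the preceding character is read in a cs-column (for
--     q₁ = 0 cyclically the last column, which is cs), where all rows agree.
--   * c is a ps-column and row j₁ is filled at c: the predecessors of (j₁,q₁) and (j₂,q₂)
--     are both in column c with equal region contents, which forces q₂ = q₁ and puts
--     (j₂,q₂) into the a-suffix of (j₁,q₁) — a contradiction.
--   * c is a ps-column and row j₁ has a gap at c: rows are right-justified, so row j₁
--     holds all of α̃⁺_iΔ^{j₁}_i from q₁ on.  If row j were filled at c, α̃⁺_iΔ^j_i would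
--     properly end with α̃⁺_iΔ^{j₁}_i and α̃⁺_i would occur twice in S^j.  So rows j and
--     j₁ both have gaps from c back to the start of the region, and both read their
--     preceding character in the cs-column before it.

open import Defs
open import Data.Fin using (Fin)
open import Data.Nat using (ℕ)
open import Data.Maybe using (just)
open import Data.Product using (_,_)
open import Relation.Nullary using (¬_)
open import Relation.Binary.PropositionalEquality using (_≡_)

open import Data.Nat using (zero; suc; _+_; _∸_; _≤_; _<_; _⊔_; z≤n; s≤s; s≤s⁻¹; _<?_)
open import Data.Nat.Properties
  using (+-assoc; +-comm; +-identityʳ; +-suc; ≤-trans; ≤-refl; <⇒≤; ≮⇒≥; n<1+n; <-trans;
         m≤m⊔n; m≤n⊔m; m+[n∸m]≡n; m∸n+n≡m; m<n⇒0<n∸m; +-cancelˡ-<; m≤n⇒m<n∨m≡n;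
         m+1+n≢m; 0≢1+n; <⇒≱; n≮n)
open import Data.Fin using (zero; suc; inject₁; fromℕ; toℕ; _≟_)
open import Data.List using (List; []; _∷_; _++_; length; take; drop; replicate; map; foldr)
open import Data.List.Properties
  using (++-assoc; ++-identityʳ; length-++; length-map; length-replicate; length-drop;
         drop-map; map-injective; take++drop≡id; ∷-injectiveʳ)
open import Data.List.Membership.Propositional using (_∈_)
open import Data.List.Membership.Propositional.Properties using (∈-allFin)
open import Data.List.Relation.Unary.Any using (here; there)
open import Data.Maybe using (Maybe; nothing; fromMaybe)
open import Data.Maybe.Properties using (just-injective)
open import Data.Product using (∃-syntax; _×_; proj₁; proj₂)
open import Data.Sum using (_⊎_; inj₁; inj₂)
open import Data.Empty using (⊥; ⊥-elim)
open import Data.Unit using (tt)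
open import Relation.Nullary using (yes; no)
open import Relation.Binary.PropositionalEquality
  using (_≢_; refl; sym; trans; cong; cong₂; subst; subst₂; module ≡-Reasoning)
open ≡-Reasoning

private variable
  A B : Set

pos⇒suc : ∀ {n} → 0 < n → ∃[ n′ ] n ≡ suc n′
pos⇒suc {suc n} _ = n , refl

split-offset : ∀ {q a d} → a ≤ q → d ≤ q ∸ a → q ≡ (a + d) + (q ∸ a ∸ d)
split-offset {q} {a} {d} a≤q d≤ = begin
  q                       ≡⟨ sym (m+[n∸m]≡n a≤q) ⟩
  a + (q ∸ a)             ≡⟨ cong (a +_) (sym (m+[n∸m]≡n d≤)) ⟩
  a + (d + (q ∸ a ∸ d))   ≡⟨ sym (+-assoc a d _) ⟩
  (a + d) + (q ∸ a ∸ d)   ∎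

≤-foldr-⊔ : (f : B → ℕ) {x : B} {xs : List B} → x ∈ xs → f x ≤ foldr _⊔_ 0 (map f xs)
≤-foldr-⊔ f {xs = y ∷ _} (here refl) = m≤m⊔n (f y) _
≤-foldr-⊔ f {xs = y ∷ _} (there x∈) = ≤-trans (≤-foldr-⊔ f x∈) (m≤n⊔m (f y) _)

at-++ˡ : (xs ys : List A) {n : ℕ} → n < length xs → at (xs ++ ys) n ≡ at xs n
at-++ˡ (x ∷ xs) ys {zero}  _         = refl
at-++ˡ (x ∷ xs) ys {suc n} (s≤s n<l) = at-++ˡ xs ys n<l

at-++ʳ : (xs ys : List A) (n : ℕ) → at (xs ++ ys) (length xs + n) ≡ at ys n
at-++ʳ []       ys n = refl
at-++ʳ (x ∷ xs) ys n = at-++ʳ xs ys n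

at-drop : ∀ q (xs : List A) n → at (drop q xs) n ≡ at xs (q + n)
at-drop zero    xs       n = refl
at-drop (suc q) []       n = refl
at-drop (suc q) (x ∷ xs) n = at-drop q xs n

at-drop-head : ∀ q (xs : List A) → at (drop q xs) 0 ≡ at xs q
at-drop-head q xs = trans (at-drop q xs 0) (cong (at xs) (+-identityʳ q))

at-drop-next : ∀ q (xs : List A) → at (drop q xs) 1 ≡ at xs (suc q)
at-drop-next q xs = trans (at-drop q xs 1) (cong (at xs) (+-comm q 1))

at-replicate : ∀ n (x : A) {o} → o < n → at (replicate n x) o ≡ just x
at-replicate (suc n) x {zero}  _         = refl
at-replicate (suc n) x {suc o} (s≤s o<n) = at-replicate n x o<n

at-map : (f : A → B) (xs : List A) {o : ℕ} {x : A} → at xs o ≡ just x → at (map f xs) o ≡ just (f x)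
at-map f (x ∷ xs) {zero}  refl = refl
at-map f (x ∷ xs) {suc o} e    = at-map f xs e

at-inside : (xs : List A) {o : ℕ} → o < length xs → ∃[ x ] at xs o ≡ just x
at-inside (x ∷ xs) {zero}  _         = x , refl
at-inside (x ∷ xs) {suc o} (s≤s o<l) = at-inside xs o<l

at-bound : (xs : List A) {o : ℕ} {x : A} → at xs o ≡ just x → o < length xs
at-bound (x ∷ xs) {zero}  _ = s≤s z≤n
at-bound (x ∷ xs) {suc o} e = s≤s (at-bound xs e)

drop-at : (xs : List A) {o : ℕ} {x : A} → at xs o ≡ just x → drop o xs ≡ x ∷ drop (suc o) xs
drop-at (x ∷ xs) {zero}  refl = refl
drop-at (x ∷ xs) {suc o} e    = drop-at xs e

drop-++ʳ : (xs ys : List A) (n : ℕ) → drop (length xs + n) (xs ++ ys) ≡ drop n ys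
drop-++ʳ []       ys n = refl
drop-++ʳ (x ∷ xs) ys n = drop-++ʳ xs ys n

drop-++ˡ : (xs ys : List A) {n : ℕ} → n ≤ length xs → drop n (xs ++ ys) ≡ drop n xs ++ ys
drop-++ˡ xs       ys {zero}  _         = refl
drop-++ˡ (x ∷ xs) ys {suc n} (s≤s n≤l) = drop-++ˡ xs ys n≤l

drop-replicate : ∀ n (x : A) o → drop o (replicate n x) ≡ replicate (n ∸ o) x
drop-replicate n       x zero    = refl
drop-replicate zero    x (suc o) = refl
drop-replicate (suc n) x (suc o) = drop-replicate n x o

take-nonempty : ∀ {n} (xs : List A) → 0 < n → xs ≢ [] → take n xs ≢ []
take-nonempty {n = suc n} (x ∷ xs) _ _ ()
take-nonempty []                   _ ne _ = ne refl

nonempty-length : (xs : List A) → xs ≢ [] → 0 < length xs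
nonempty-length []       ne = ⊥-elim (ne refl)
nonempty-length (x ∷ xs) _  = s≤s z≤n

++-nonempty : (xs : List A) {ys : List A} → xs ≢ [] → xs ++ ys ≢ []
++-nonempty []       ne _  = ne refl
++-nonempty (x ∷ xs) _  ()

record Around {A : Set} (xs blk : List A) (s : ℕ) : Set where
  field
    pre post   : List A
    decompose  : xs ≡ pre ++ blk ++ post
    pre-length : length pre ≡ s
open Around

at-block : {xs blk : List A} {s o : ℕ} → Around xs blk s → o < length blk → at xs (s + o) ≡ at blk o
at-block {blk = blk} {o = o} record { pre = pre ; post = post ; decompose = refl ; pre-length = refl } o<l =
  trans (at-++ʳ pre (blk ++ post) o) (at-++ˡ blk post o<l)

drop-block : {xs u v : List A} {s o : ℕ} (sp : Around xs (u ++ v) s) → o ≤ length u →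
             drop (s + o) xs ≡ drop o u ++ v ++ post sp
drop-block {u = u} {v} {o = o} record { pre = pre ; post = post ; decompose = refl ; pre-length = refl } o≤l =
  trans (drop-++ʳ pre ((u ++ v) ++ post) o) (trans (cong (drop o) (++-assoc u v post)) (drop-++ˡ u (v ++ post) o≤l))

around-shift : {xs h ys blk : List A} {t s : ℕ} → xs ≡ h ++ ys → length h ≡ t →
               Around ys blk s → Around xs blk (t + s)
around-shift {h = h} {blk = blk} xs≡ h-len sp = record
  { pre        = h ++ pre sp
  ; post       = post sp
  ; decompose  = trans xs≡ (trans (cong (h ++_) (decompose sp)) (sym (++-assoc h (pre sp) (blk ++ post sp))))
  ; pre-length = trans (length-++ h) (cong₂ _+_ h-len (pre-length sp))
  }

around-right : {xs u v : List A} {s : ℕ} → Around xs (u ++ v) s → Around xs v (s + length u)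
around-right {u = u} {v} sp = record
  { pre        = pre sp ++ u
  ; post       = post sp
  ; decompose  = trans (decompose sp) (trans (cong (pre sp ++_) (++-assoc u v (post sp)))
                                             (sym (++-assoc (pre sp) u (v ++ post sp))))
  ; pre-length = trans (length-++ (pre sp)) (cong (_+ length u) (pre-length sp))
  }

record Shape {A : Set} {r : ℕ} (la : Fin (suc r) → ℕ) (ld : Fin r → ℕ)
             (a : Fin (suc r) → List A) (d : Fin r → List A) : Set where
  field
    a-length : ∀ k → length (a k) ≡ la k
    d-length : ∀ k → length (d k) ≡ ld k
open Shape

shape-tail : ∀ {r} {la : Fin (suc (suc r)) → ℕ} {ld : Fin (suc r) → ℕ}
               {a : Fin (suc (suc r)) → List A} {d} →
             Shape la ld a d → Shape (λ k → la (suc k)) (λ k → ld (suc k)) (λ k → a (suc k)) (λ k → d (suc k))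
shape-tail sh = record { a-length = λ k → a-length sh (suc k) ; d-length = λ k → d-length sh (suc k) }

own-shape : ∀ {r} (a : Fin (suc r) → List A) (d : Fin r → List A) →
            Shape (λ k → length (a k)) (λ k → length (d k)) a d
own-shape a d = record { a-length = λ _ → refl ; d-length = λ _ → refl }

blockStart : ∀ {r} → (Fin (suc r) → ℕ) → (Fin r → ℕ) → Fin (suc r) → ℕ
blockStart          la ld zero    = 0
blockStart {suc r}  la ld (suc k) = la zero + ld zero + blockStart (λ i → la (suc i)) (λ i → ld (suc i)) k

interleave-suc : ∀ {r} (a : Fin (suc (suc r)) → List A) d →
                 interleave a d ≡ (a zero ++ d zero) ++ interleave (λ k → a (suc k)) (λ k → d (suc k))
interleave-suc a d = sym (++-assoc (a zero) (d zero) _)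

interleave-head : ∀ {r} (a : Fin (suc r) → List A) d → ∃[ post ] interleave a d ≡ a zero ++ post
interleave-head {r = zero}  a d = [] , sym (++-identityʳ (a zero))
interleave-head {r = suc r} a d = _ , refl

interleave-last : ∀ {r} (a : Fin (suc r) → List A) d → ∃[ pre ] interleave a d ≡ pre ++ a (fromℕ r)
interleave-last {r = zero}  a d = [] , refl
interleave-last {r = suc r} a d with interleave-last (λ k → a (suc k)) (λ k → d (suc k))
... | pre , e = (a zero ++ d zero) ++ pre ,
  trans (interleave-suc a d) (trans (cong ((a zero ++ d zero) ++_) e) (sym (++-assoc (a zero ++ d zero) pre _)))

head-length : ∀ {r la ld} {a : Fin (suc (suc r)) → List A} {d : Fin (suc r) → List A} →
              Shape la ld a d → length (a zero ++ d zero) ≡ la zero + ld zero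
head-length {a = a} sh = trans (length-++ (a zero)) (cong₂ _+_ (a-length sh zero) (d-length sh zero))

interleave-length : ∀ {r la ld} {a : Fin (suc r) → List A} {d : Fin r → List A}
                      {a′ : Fin (suc r) → List B} {d′ : Fin r → List B} →
                    Shape la ld a d → Shape la ld a′ d′ → length (interleave a d) ≡ length (interleave a′ d′)
interleave-length {r = zero}  sh sh′ = trans (a-length sh zero) (sym (a-length sh′ zero))
interleave-length {r = suc r} {a = a} {d} {a′} {d′} sh sh′ = begin
  length (interleave a d)
    ≡⟨ trans (cong length (interleave-suc a d)) (length-++ (a zero ++ d zero)) ⟩
  length (a zero ++ d zero) + length (interleave (λ k → a (suc k)) (λ k → d (suc k)))
    ≡⟨ cong₂ _+_ (trans (head-length sh) (sym (head-length sh′)))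
                 (interleave-length (shape-tail sh) (shape-tail sh′)) ⟩
  length (a′ zero ++ d′ zero) + length (interleave (λ k → a′ (suc k)) (λ k → d′ (suc k)))
    ≡⟨ sym (trans (cong length (interleave-suc a′ d′)) (length-++ (a′ zero ++ d′ zero))) ⟩
  length (interleave a′ d′) ∎

split-a : ∀ {r la ld} {a : Fin (suc r) → List A} {d : Fin r → List A} → Shape la ld a d → ∀ k →
          Around (interleave a d) (a k) (blockStart la ld k)
split-a {a = a} {d} sh zero with interleave-head a d
... | post , e = record { pre = [] ; post = post ; decompose = e ; pre-length = refl }
split-a {r = suc r} {a = a} {d} sh (suc k) =
  around-shift (interleave-suc a d) (head-length sh) (split-a (shape-tail sh) k)

split-d : ∀ {r la ld} {a : Fin (suc r) → List A} {d : Fin r → List A} → Shape la ld a d → ∀ k →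
          Around (interleave a d) (a (inject₁ k) ++ d k ++ a (suc k)) (blockStart la ld (inject₁ k))
split-d {a = a} {d} sh zero with interleave-head (λ k → a (suc k)) (λ k → d (suc k))
... | post , e = record
  { pre        = []
  ; post       = post
  ; decompose  = trans (cong (λ z → a zero ++ d zero ++ z) e)
                       (sym (trans (++-assoc (a zero) (d zero ++ a (suc zero)) post)
                                   (cong (a zero ++_) (++-assoc (d zero) (a (suc zero)) post))))
  ; pre-length = refl
  }
split-d {r = suc r} {a = a} {d} sh (suc k) =
  around-shift (interleave-suc a d) (head-length sh) (split-d (shape-tail sh) k)

split-d′ : ∀ {r la ld} {a : Fin (suc r) → List A} {d : Fin r → List A} → Shape la ld a d → ∀ k →
           Around (interleave a d) (d k ++ a (suc k)) (blockStart la ld (inject₁ k) + la (inject₁ k))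
split-d′ {a = a} sh k =
  subst (Around _ _) (cong (_ +_) (a-length sh (inject₁ k))) (around-right {u = a (inject₁ k)} (split-d sh k))

data Position {r : ℕ} (la : Fin (suc r) → ℕ) (ld : Fin r → ℕ) (q : ℕ) : Set where
  in-a : (k : Fin (suc r)) (o : ℕ) → o < la k → q ≡ blockStart la ld k + o → Position la ld q
  in-d : (k : Fin r) (o : ℕ) → o < ld k →
         q ≡ blockStart la ld (inject₁ k) + la (inject₁ k) + o → Position la ld q

position-shift : ∀ {r} {la : Fin (suc (suc r)) → ℕ} {ld : Fin (suc r) → ℕ} {q q′} →
                 q ≡ (la zero + ld zero) + q′ →
                 Position (λ k → la (suc k)) (λ k → ld (suc k)) q′ → Position la ld q
position-shift {la = la} {ld} e (in-a k o o< refl) =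
  in-a (suc k) o o< (trans e (sym (+-assoc (la zero + ld zero) _ o)))
position-shift {la = la} {ld} e (in-d k o o< refl) =
  in-d (suc k) o o< (trans e (trans (sym (+-assoc (la zero + ld zero) _ o))
                                    (cong (_+ o) (sym (+-assoc (la zero + ld zero) _ _)))))

locate : ∀ {r la ld} {a : Fin (suc r) → List A} {d : Fin r → List A} → Shape la ld a d →
         ∀ q → q < length (interleave a d) → Position la ld q
locate {r = zero} sh q q<l = in-a zero q (subst (q <_) (a-length sh zero) q<l) refl
locate {r = suc r} {la} {ld} {a} {d} sh q q<l with q <? la zero
... | yes q<a = in-a zero q q<a refl
... | no q≮a with q ∸ la zero <? ld zero
...   | yes q<d = in-d zero (q ∸ la zero) q<d (sym (m+[n∸m]≡n (≮⇒≥ q≮a)))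
...   | no q≮d = position-shift q≡ (locate (shape-tail sh) _ bound)
  where
  q≡ : q ≡ (la zero + ld zero) + (q ∸ la zero ∸ ld zero)
  q≡ = split-offset (≮⇒≥ q≮a) (≮⇒≥ q≮d)
  rest = interleave (λ k → a (suc k)) (λ k → d (suc k))
  bound : q ∸ la zero ∸ ld zero < length rest
  bound = +-cancelˡ-< (la zero + ld zero) _ _
    (subst₂ _<_ q≡ (trans (cong length (interleave-suc a d))
                          (trans (length-++ (a zero ++ d zero)) (cong (_+ length rest) (head-length sh)))) q<l)

padded-suffix : ∀ k (P : List A) o →
  (∃[ k′ ] drop o (replicate k nothing ++ map just P) ≡ nothing ∷ replicate k′ nothing ++ map just P) ⊎
  (∃[ n ] drop o (replicate k nothing ++ map just P) ≡ map just (drop n P))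
padded-suffix zero    P o       = inj₂ (o , drop-map o P)
padded-suffix (suc k) P zero    = inj₁ (k , refl)
padded-suffix (suc k) P (suc o) = padded-suffix k P o

filled-head : (X : List A) {y : Maybe A} {ys : List (Maybe A)} → map just X ≡ y ∷ ys → ∃[ b ] y ≡ just b
filled-head (x ∷ X) refl = x , refl

padded-filled-next : ∀ k (P : List A) o {a y ys} →
  drop o (replicate k nothing ++ map just P) ≡ just a ∷ y ∷ ys → ∃[ b ] y ≡ just b
padded-filled-next k P o e with padded-suffix k P o
... | inj₁ (_ , e′) with trans (sym e′) e
...   | ()
padded-filled-next k P o e | inj₂ (n , e′) with drop n P | trans (sym e′) e
... | []    | ()
... | _ ∷ X | e″ = filled-head X (∷-injectiveʳ e″)

padded-last : ∀ k (P : List A) o {y} → P ≢ [] →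
  drop o (replicate k nothing ++ map just P) ≡ y ∷ [] → ∃[ b ] y ≡ just b
padded-last k P o P≢[] e with padded-suffix k P o
... | inj₂ (n , e′) = filled-head (drop n P) (trans (sym e′) e)
... | inj₁ (zero , e′) with P | trans (sym e′) e
...   | []    | _  = ⊥-elim (P≢[] refl)
...   | _ ∷ _ | ()
padded-last k P o P≢[] e | inj₁ (suc k′ , e′) with trans (sym e′) e
... | ()

padded-after-gap : ∀ k (P : List A) o {b ys} →
  drop o (replicate k nothing ++ map just P) ≡ nothing ∷ just b ∷ ys → just b ∷ ys ≡ map just P
padded-after-gap k P o e with padded-suffix k P o
... | inj₁ (zero , e′) = sym (∷-injectiveʳ (trans (sym e′) e))
... | inj₁ (suc k′ , e′) with trans (sym e′) e
...   | ()
padded-after-gap k P o e | inj₂ (n , e′) with drop n P | trans (sym e′) e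
... | []    | ()
... | _ ∷ _ | ()

padded-filled-suffix : ∀ k (P : List A) o {a P′} →
  drop o (replicate k nothing ++ map just P) ≡ just a ∷ map just P′ → ∃[ Y ] P ≡ Y ++ a ∷ P′
padded-filled-suffix k P o e with padded-suffix k P o
... | inj₁ (_ , e′) with trans (sym e′) e
...   | ()
padded-filled-suffix k P o {a} {P′} e | inj₂ (n , e′) =
  take n P , trans (sym (take++drop≡id n P)) (cong (take n P ++_) (map-injective just-injective (trans (sym e′) e)))

occursAt-middle : (x u y : List A) → OccursAt u (x ++ u ++ y) (length x)
occursAt-middle x u y =
  trans (cong (take (length u)) (trans (cong (λ n → drop n (x ++ u ++ y)) (sym (+-identityʳ (length x))))
                                       (drop-++ʳ x (u ++ y) 0)))
        (take-prefix u y)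
  where
  take-prefix : (u y : List A) → take (length u) (u ++ y) ≡ u
  take-prefix []      y = refl
  take-prefix (c ∷ u) y = cong (c ∷_) (take-prefix u y)

occursOnce-prefix : {u s x y x′ y′ : List A} → OccursOnce u s →
                    s ≡ x ++ u ++ y → s ≡ x′ ++ u ++ y′ → length x ≡ length x′
occursOnce-prefix {u = u} {x = x} {y} {x′} {y′} (p , _ , unique) refl e′ =
  trans (unique _ (occursAt-middle x u y))
        (sym (unique _ (subst (λ s → OccursAt u s (length x′)) (sym e′) (occursAt-middle x′ u y′))))

-- If u occurs exactly once in  s = x ++ w ++ R  where w begins with u, then w cannot
-- properly end with a word that also begins with u: that would be a second occurrence.
once-no-proper-suffix : {u z z′ x R s Y : List A} {a : A} → OccursOnce u s →
                        s ≡ x ++ (u ++ z) ++ R → u ++ z ≡ Y ++ a ∷ u ++ z′ → ⊥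
once-no-proper-suffix {u = u} {z} {z′} {x} {R} {s} {Y} {a} once s≡ w≡ =
  m+1+n≢m (length x)
    (sym (trans (occursOnce-prefix {x = x} {z ++ R} {x ++ Y ++ a ∷ []} {z′ ++ R} once first second) shifted-length))
  where
  first : s ≡ x ++ u ++ z ++ R
  first = trans s≡ (cong (x ++_) (++-assoc u z R))
  second : s ≡ (x ++ Y ++ a ∷ []) ++ u ++ z′ ++ R
  second = begin
    s                                   ≡⟨ s≡ ⟩
    x ++ (u ++ z) ++ R                  ≡⟨ cong (λ w → x ++ w ++ R) w≡ ⟩
    x ++ (Y ++ a ∷ u ++ z′) ++ R        ≡⟨ cong (x ++_) (++-assoc Y (a ∷ u ++ z′) R) ⟩
    x ++ Y ++ a ∷ (u ++ z′) ++ R        ≡⟨ cong (λ w → x ++ Y ++ a ∷ w) (++-assoc u z′ R) ⟩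
    x ++ Y ++ (a ∷ []) ++ u ++ z′ ++ R  ≡⟨ sym (trans (++-assoc x (Y ++ a ∷ []) _)
                                                     (cong (x ++_) (++-assoc Y (a ∷ []) _))) ⟩
    (x ++ Y ++ a ∷ []) ++ u ++ z′ ++ R  ∎
  shifted-length : length (x ++ Y ++ a ∷ []) ≡ length x + suc (length Y)
  shifted-length = trans (length-++ x) (cong (length x +_) (trans (length-++ Y) (+-comm (length Y) 1)))

-- The empty string occurs at every position, so never exactly once.
empty-not-once : {s : List A} → ¬ OccursOnce [] s
empty-not-once (p , _ , unique) = 0≢1+n (trans (unique 0 refl) (sym (unique 1 refl)))

extend0-inject₁ : ∀ {r} (f : Fin r → ℕ) i → extend0 f (inject₁ i) ≡ f i
extend0-inject₁ {suc r} f zero    = refl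
extend0-inject₁ {suc r} f (suc i) = extend0-inject₁ (λ k → f (suc k)) i

extend0-fromℕ : ∀ {r} (f : Fin r → ℕ) → extend0 f (fromℕ r) ≡ 0
extend0-fromℕ {zero}  f = refl
extend0-fromℕ {suc r} f = extend0-fromℕ (λ k → f (suc k))

extend0-below : ∀ {r} (f : Fin r → ℕ) (len : Fin (suc r) → ℕ) →
                (∀ i → f i < len (inject₁ i)) → 0 < len (fromℕ r) → ∀ x → extend0 f x < len x
extend0-below {zero}  f len _     last zero    = last
extend0-below {suc r} f len below _    zero    = below zero
extend0-below {suc r} f len below last (suc x) =
  extend0-below (λ k → f (suc k)) (λ k → len (suc k)) (λ k → below (suc k)) last x

extend0-suc-below : ∀ {r} (f : Fin r → ℕ) (len : Fin (suc r) → ℕ) →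
                    (∀ i → 1 ≤ toℕ i → f i < len (inject₁ i)) → 0 < len (fromℕ r) →
                    ∀ k → extend0 f (suc k) < len (suc k)
extend0-suc-below {suc r} f len below last k =
  extend0-below (λ i → f (suc i)) (λ i → len (suc i)) (λ i → below (suc i) (s≤s z≤n)) last k

module Columns (I : Setting) where
  open Alignment I

  tag : ℕ → Maybe (Tag r)
  tag q = at layout q

  csWidth : Fin (suc r) → ℕ
  csWidth k = length (αdia k)

  rowD : Fin m → Fin r → List (Maybe C)
  rowD j i = replicate (width i ∸ length (psContent j i)) nothing ++ map just (psContent j i)

  content≤width : ∀ j i → length (psContent j i) ≤ width i
  content≤width j i = ≤-foldr-⊔ (λ j → length (psContent j i)) (∈-allFin j)

  rowD-length : ∀ j i → length (rowD j i) ≡ width i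
  rowD-length j i = begin
    length (rowD j i)
      ≡⟨ length-++ (replicate (width i ∸ length (psContent j i)) nothing) ⟩
    length (replicate (width i ∸ length (psContent j i)) nothing) + length (map just (psContent j i))
      ≡⟨ cong₂ _+_ (length-replicate (width i ∸ length (psContent j i))) (length-map just (psContent j i)) ⟩
    width i ∸ length (psContent j i) + length (psContent j i)
      ≡⟨ m∸n+n≡m (content≤width j i) ⟩
    width i ∎

  layout-shape : Shape csWidth width (λ k → replicate (csWidth k) cs) (λ i → replicate (width i) (ps i))
  layout-shape = record { a-length = λ k → length-replicate (csWidth k)
                        ; d-length = λ i → length-replicate (width i) }

  row-shape : ∀ j → Shape csWidth width (λ k → map just (αdia k)) (rowD j)
  row-shape j = record { a-length = λ k → length-map just (αdia k) ; d-length = rowD-length j }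

  row-length : ∀ j → length (row j) ≡ N
  row-length j = interleave-length (row-shape j) layout-shape

  αplus-unique : ∀ i → αplus (inject₁ i) ≡ suffixOfLen (ℓ i) (α (inject₁ i))
  αplus-unique i = cong (λ n → drop (length (α (inject₁ i)) ∸ n) (α (inject₁ i))) (extend0-inject₁ ℓ i)

  -- α̃⁺_i is nonempty, since the empty string does not occur exactly once.
  content-nonempty : ∀ j i → psContent j i ≢ []
  content-nonempty j i = ++-nonempty (αplus (inject₁ i)) λ empty →
    empty-not-once {s = str α Δ j}
      (subst (λ u → OccursOnce u (str α Δ j)) (trans (sym (αplus-unique i)) empty) (ℓ-once i j))

  -- By the standing assumption, every cs-region after the first is nonempty.
  cs-region-nonempty : ∀ k → ∃[ n ] csWidth (suc k) ≡ suc n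
  cs-region-nonempty k = pos⇒suc (nonempty-length (αdia (suc k))
    (take-nonempty (α (suc k)) (m<n⇒0<n∸m ℓ⁺<) (α-nonempty (suc k))))
    where
    ℓ⁺< : ℓ⁺ (suc k) < length (α (suc k))
    ℓ⁺< = extend0-suc-below ℓ (λ x → length (α x)) standing
                            (nonempty-length (α (fromℕ r)) (α-nonempty (fromℕ r))) k

  -- The last cs-region is nonempty, since α̃⁺_{r+1} is empty.
  last-region-nonempty : ∃[ n ] csWidth (fromℕ r) ≡ suc n
  last-region-nonempty = pos⇒suc (nonempty-length (αdia (fromℕ r))
    (take-nonempty (α (fromℕ r))
      (subst (λ n → 0 < length (α (fromℕ r)) ∸ n) (sym (extend0-fromℕ ℓ))
             (nonempty-length (α (fromℕ r)) (α-nonempty (fromℕ r))))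
      (α-nonempty (fromℕ r))))

  -- α̃⁺_i occurs exactly once in S^j, so α̃⁺_iΔ^j_i cannot properly end with α̃⁺_iΔ^{j′}_i.
  content-not-extended : ∀ j j′ i Y a → psContent j i ≢ Y ++ a ∷ psContent j′ i
  content-not-extended j j′ i Y a extended =
    once-no-proper-suffix {x = pre sp ++ αdia (inject₁ i)} {R} (subst (λ v → OccursOnce v (str α Δ j)) (sym (αplus-unique i)) (ℓ-once i j))
                          around extended
    where
    sp = split-d (own-shape α (Δ j)) i
    R = α (suc i) ++ post sp
    around : str α Δ j ≡ (pre sp ++ αdia (inject₁ i)) ++ psContent j i ++ R
    around = begin
      str α Δ j
        ≡⟨ decompose sp ⟩
      pre sp ++ (α (inject₁ i) ++ Δ j i ++ α (suc i)) ++ post sp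
        ≡⟨ cong (pre sp ++_) (trans (++-assoc (α (inject₁ i)) _ (post sp))
                                    (cong (α (inject₁ i) ++_) (++-assoc (Δ j i) (α (suc i)) (post sp)))) ⟩
      pre sp ++ α (inject₁ i) ++ Δ j i ++ R
        ≡⟨ cong (λ w → pre sp ++ w ++ Δ j i ++ R)
                (sym (take++drop≡id (length (α (inject₁ i)) ∸ ℓ⁺ (inject₁ i)) (α (inject₁ i)))) ⟩
      pre sp ++ (αdia (inject₁ i) ++ αplus (inject₁ i)) ++ Δ j i ++ R
        ≡⟨ cong (pre sp ++_) (trans (++-assoc (αdia (inject₁ i)) _ _)
                                    (cong (αdia (inject₁ i) ++_) (sym (++-assoc (αplus (inject₁ i)) (Δ j i) R)))) ⟩
      pre sp ++ αdia (inject₁ i) ++ psContent j i ++ R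
        ≡⟨ sym (++-assoc (pre sp) (αdia (inject₁ i)) _) ⟩
      (pre sp ++ αdia (inject₁ i)) ++ psContent j i ++ R ∎

  cell-at : ∀ j {q x} → at (row j) q ≡ just x → cell j q ≡ x
  cell-at j e rewrite e = refl

  regionRest-step : ∀ i {ts x xs} → regionRest i (ps i ∷ ts) (x ∷ xs) ≡ x ∷ regionRest i ts xs
  regionRest-step i with i ≟ i
  ... | yes _  = refl
  ... | no i≢i = ⊥-elim (i≢i refl)

  regionRest-cs : ∀ i ts (xs : List (Maybe C)) → regionRest i (cs ∷ ts) xs ≡ []
  regionRest-cs i ts []      = refl
  regionRest-cs i ts (_ ∷ _) = refl

  regionRest-run : ∀ i {n} (R : List (Maybe C)) ts rest → length R ≡ n →
                   regionRest i (replicate n (ps i) ++ cs ∷ ts) (R ++ rest) ≡ R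
  regionRest-run i []      ts rest refl = regionRest-cs i ts rest
  regionRest-run i (x ∷ R) ts rest refl = trans (regionRest-step i) (cong (x ∷_) (regionRest-run i R ts rest refl))

  data Column (q : ℕ) : Set where
    cs-column : (c : C) → tag q ≡ just cs → (∀ j → cell j q ≡ just c) → Column q
    ps-column : (i : Fin r) (o : ℕ) → tag q ≡ just (ps i) →
                tag (suc q) ≡ just (ps i) ⊎ tag (suc q) ≡ just cs →
                (∀ j → δ j q i ≡ drop o (rowD j i)) → Column q

  cs-block-column : ∀ k o → o < csWidth k → Column (blockStart csWidth width k + o)
  cs-block-column k o o< with at-inside (αdia k) o<
  ... | c , c-at =
    cs-column c (trans (at-block (split-a layout-shape k) (subst (o <_) (sym (length-replicate (csWidth k))) o<))
                       (at-replicate (csWidth k) cs o<))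
                cells
    where
    cells : ∀ j → cell j (blockStart csWidth width k + o) ≡ just c
    cells j =
      cell-at j (trans (at-block (split-a (row-shape j) k) (subst (o <_) (sym (length-map just (αdia k))) o<))
                       (at-map just (αdia k) c-at))

  -- Offset o of the ps-region i: the layout continues with a run of ps i tags followed by
  -- the nonempty cs-region i+1, and every row with the rest of its padded row.
  ps-block-column : ∀ i o → o < width i → Column (blockStart csWidth width (inject₁ i) + csWidth (inject₁ i) + o)
  ps-block-column i o o< with cs-region-nonempty i | pos⇒suc (m<n⇒0<n∸m o<)
  ... | n , next-width | w′ , rest-width =
    ps-column i o (trans (sym (at-drop-head q layout)) (cong (λ xs → at xs 0) after′)) next-tag contents
    where
    q = blockStart csWidth width (inject₁ i) + csWidth (inject₁ i) + o
    beyond = post (split-d′ layout-shape i)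
    after : drop q layout ≡ replicate (width i ∸ o) (ps i) ++ cs ∷ replicate n cs ++ beyond
    after = begin
      drop q layout
        ≡⟨ drop-block (split-d′ layout-shape i) (subst (o ≤_) (sym (length-replicate (width i))) (<⇒≤ o<)) ⟩
      drop o (replicate (width i) (ps i)) ++ replicate (csWidth (suc i)) cs ++ beyond
        ≡⟨ cong₂ _++_ (drop-replicate (width i) (ps i) o) (cong (λ l → replicate l cs ++ beyond) next-width) ⟩
      replicate (width i ∸ o) (ps i) ++ cs ∷ replicate n cs ++ beyond ∎
    after′ : drop q layout ≡ ps i ∷ replicate w′ (ps i) ++ cs ∷ replicate n cs ++ beyond
    after′ = trans after (cong (λ l → replicate l (ps i) ++ cs ∷ replicate n cs ++ beyond) rest-width)
    next-cell : ∀ w′ → let xs = ps i ∷ replicate w′ (ps i) ++ cs ∷ replicate n cs ++ beyond in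
                at xs 1 ≡ just (ps i) ⊎ at xs 1 ≡ just cs
    next-cell zero    = inj₂ refl
    next-cell (suc _) = inj₁ refl
    next-tag : tag (suc q) ≡ just (ps i) ⊎ tag (suc q) ≡ just cs
    next-tag rewrite sym (at-drop-next q layout) | after′ = next-cell w′
    contents : ∀ j → δ j q i ≡ drop o (rowD j i)
    contents j =
      trans (cong₂ (regionRest i) after
                   (drop-block (split-d′ (row-shape j) i) (subst (o ≤_) (sym (rowD-length j i)) (<⇒≤ o<))))
            (regionRest-run i (drop o (rowD j i)) _ _
               (trans (length-drop o (rowD j i)) (cong (_∸ o) (rowD-length j i))))

  column : ∀ q → q < N → Column q
  column q q<N with locate layout-shape q q<N
  ... | in-a k o o< refl = cs-block-column k o o<
  ... | in-d i o o< refl = ps-block-column i o o<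

  tag-bound : ∀ {q t} → tag q ≡ just t → q < N
  tag-bound = at-bound layout

  suffix-bound : ∀ {j q} → IsSuffix j q → q < N
  suffix-bound {j} {q} (c , filled) with at (row j) q in e
  ... | just _  = subst (q <_) (row-length j) (at-bound (row j) e)
  ... | nothing with filled
  ...   | ()

  column-kind : ∀ {q} → q < N → tag q ≡ just cs ⊎ ∃[ i ] tag q ≡ just (ps i)
  column-kind {q} q<N with column q q<N
  ... | cs-column _ t _     = inj₁ t
  ... | ps-column i _ t _ _ = inj₂ (i , t)

  cs-cells : ∀ {q} → tag q ≡ just cs → ∃[ c ] ∀ j → cell j q ≡ just c
  cs-cells {q} t with column q (tag-bound t)
  ... | cs-column c _ cells    = c , cells
  ... | ps-column _ _ t′ _ _ with trans (sym t) t′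
  ...   | ()

  ps-facts : ∀ {q i} → tag q ≡ just (ps i) →
             (tag (suc q) ≡ just (ps i) ⊎ tag (suc q) ≡ just cs) × ∃[ o ] ∀ j → δ j q i ≡ drop o (rowD j i)
  ps-facts {q} t with column q (tag-bound t)
  ... | cs-column _ t′ _ with trans (sym t) t′
  ...   | ()
  ps-facts {q} t | ps-column i o t′ next contents with trans (sym t) t′
  ...   | refl = next , o , contents

  same-region : ∀ {q i i′} → tag q ≡ just (ps i) → tag (suc q) ≡ just (ps i′) → i ≡ i′
  same-region t t′ with proj₁ (ps-facts t)
  ... | inj₁ t″ with trans (sym t″) t′
  ...   | refl = refl
  same-region t t′ | inj₂ t″ with trans (sym t″) t′
  ...   | ()

  last-column-cs : tag (N ∸ 1) ≡ just cs
  last-column-cs with interleave-last (λ k → replicate (csWidth k) cs) (λ i → replicate (width i) (ps i))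
                    | last-region-nonempty
  ... | front , lay | n , last-width = begin
    at layout (N ∸ 1)                          ≡⟨ cong₂ at lay′ position ⟩
    at (front ++ replicate (suc n) cs) (length front + n) ≡⟨ at-++ʳ front _ n ⟩
    at (replicate (suc n) cs) n                ≡⟨ at-replicate (suc n) cs (n<1+n n) ⟩
    just cs                                    ∎
    where
    lay′ : layout ≡ front ++ replicate (suc n) cs
    lay′ = trans lay (cong (λ l → front ++ replicate l cs) last-width)
    position : N ∸ 1 ≡ length front + n
    position = cong (_∸ 1) (trans (cong length lay′)
                 (trans (length-++ front) (trans (cong (length front +_) (length-replicate (suc n))) (+-suc (length front) n))))

  δ-step : ∀ j {q i} → tag q ≡ just (ps i) → δ j q i ≡ cell j q ∷ δ j (suc q) i
  δ-step j {q} {i} t with at-inside (row j) (subst (q <_) (sym (row-length j)) (tag-bound t))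
  ... | x , x-at = begin
    regionRest i (drop q layout) (drop q (row j))
      ≡⟨ cong₂ (regionRest i) (drop-at layout t) (drop-at (row j) x-at) ⟩
    regionRest i (ps i ∷ drop (suc q) layout) (x ∷ drop (suc q) (row j))
      ≡⟨ regionRest-step i ⟩
    x ∷ δ j (suc q) i
      ≡⟨ cong (_∷ δ j (suc q) i) (sym (cell-at j x-at)) ⟩
    cell j q ∷ δ j (suc q) i ∎

  δ-cs : ∀ j {q} i → tag q ≡ just cs → δ j q i ≡ []
  δ-cs j {q} i t = trans (cong (λ ts → regionRest i ts (drop q (row j))) (drop-at layout t))
                         (regionRest-cs i (drop (suc q) layout) (drop q (row j)))

  same-class-ps : ∀ {q i j j′} → tag q ≡ just (ps i) → SameClassAt q j j′ → δ j q i ≡ δ j′ q i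
  same-class-ps {q} t same with at layout q | t
  ... | .(just (ps _)) | refl = same

  ps-same-class : ∀ {q i j j′} → tag q ≡ just (ps i) → δ j q i ≡ δ j′ q i → SameClassAt q j j′
  ps-same-class {q} t same with at layout q | t
  ... | .(just (ps _)) | refl = same

  cs-same-class : ∀ {q j j′} → tag q ≡ just cs → SameClassAt q j j′
  cs-same-class {q} t with at layout q | t
  ... | .(just cs) | refl = tt

  padded-row : ∀ {j q i xs} → tag q ≡ just (ps i) → δ j q i ≡ xs → ∃[ o ] drop o (rowD j i) ≡ xs
  padded-row {j} t δ≡ with proj₂ (ps-facts t)
  ... | o , contents = o , trans (sym (contents j)) δ≡

  -- Right-justification: inside a ps-region, a filled cell is followed by a filled cell,
  -- and the last column of the region is filled.
  filled-next : ∀ {j q i a} → tag q ≡ just (ps i) → tag (suc q) ≡ just (ps i) → cell j q ≡ just a →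
                ∃[ b ] cell j (suc q) ≡ just b
  filled-next {j} {q} {i} t t′ filled with padded-row t (trans (δ-step j t) (cong₂ _∷_ filled (δ-step j t′)))
  ... | o , suffix = padded-filled-next _ (psContent j i) o suffix

  region-end-filled : ∀ {j q i} → tag q ≡ just (ps i) → tag (suc q) ≡ just cs → ∃[ b ] cell j q ≡ just b
  region-end-filled {j} {q} {i} t t′ with padded-row t (trans (δ-step j t) (cong (cell j q ∷_) (δ-cs j i t′)))
  ... | o , suffix = padded-last _ (psContent j i) o (content-nonempty j i) suffix

  content-after-gap : ∀ {j q i b} → tag q ≡ just (ps i) → tag (suc q) ≡ just (ps i) →
                      cell j q ≡ nothing → cell j (suc q) ≡ just b → δ j (suc q) i ≡ map just (psContent j i)
  content-after-gap {j} {q} {i} {b} t t′ gap filled =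
    trans unfold (padded-after-gap _ (psContent j i) (proj₁ suffix) (proj₂ suffix))
    where
    unfold : δ j (suc q) i ≡ just b ∷ δ j (suc (suc q)) i
    unfold = trans (δ-step j t′) (cong (_∷ δ j (suc (suc q)) i) filled)
    suffix = padded-row t (trans (δ-step j t) (cong₂ _∷_ gap unfold))

  content-before : ∀ {j q i a P′} → tag q ≡ just (ps i) → cell j q ≡ just a →
                   δ j (suc q) i ≡ map just P′ → ∃[ Y ] psContent j i ≡ Y ++ a ∷ P′
  content-before {j} {q} {i} t filled rest with padded-row t (trans (δ-step j t) (cong₂ _∷_ filled rest))
  ... | o , suffix = padded-filled-suffix _ (psContent j i) o suffix

  cell-cases : ∀ j q → (∃[ a ] cell j q ≡ just a) ⊎ cell j q ≡ nothing
  cell-cases j q with cell j q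
  ... | just a  = inj₁ (a , refl)
  ... | nothing = inj₂ refl

  lastNonempty-filled : ∀ j {q c} → cell j q ≡ just c → lastNonempty j (suc q) ≡ just q
  lastNonempty-filled j {q} filled with cell j q | filled
  ... | just _ | _ = refl

  lastNonempty-gap : ∀ j {q} → cell j q ≡ nothing → lastNonempty j (suc q) ≡ lastNonempty j q
  lastNonempty-gap j {q} gap with cell j q | gap
  ... | nothing | _ = refl

  prev-after-filled : ∀ {j q c} → cell j q ≡ just c → prev j (suc q) ≡ q
  prev-after-filled {j} filled = cong (fromMaybe (N ∸ 1)) (lastNonempty-filled j filled)

  precChar-after-filled : ∀ {j q c} → cell j q ≡ just c → precChar j (suc q) ≡ just c
  precChar-after-filled {j} filled = trans (cong (cell j) (prev-after-filled filled)) filled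

  precChar-after-gap : ∀ {j q} → cell j q ≡ nothing → precChar j (suc q) ≡ precChar j q
  precChar-after-gap {j} gap = cong (λ p → cell j (fromMaybe (N ∸ 1) p)) (lastNonempty-gap j gap)

  lastNonempty-spec : ∀ j q {p} → lastNonempty j q ≡ just p →
                      p < q × IsSuffix j p × (∀ c → p < c → c < q → cell j c ≡ nothing)
  lastNonempty-spec j (suc q) {p} found with cell j q in e
  ... | just c with found
  ...   | refl = ≤-refl , (c , e) , λ c p<c c<q → ⊥-elim (<⇒≱ p<c (s≤s⁻¹ c<q))
  lastNonempty-spec j (suc q) {p} found | nothing with lastNonempty-spec j q found
  ... | p<q , filled , gaps = <-trans p<q (n<1+n q) , filled , gaps′
    where
    gaps′ : ∀ c → p < c → c < suc q → cell j c ≡ nothing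
    gaps′ c p<c (s≤s c≤q) with m≤n⇒m<n∨m≡n c≤q
    ... | inj₁ c<q  = gaps c p<c c<q
    ... | inj₂ refl = e

  -- A predecessor column p with p+1 < N comes from lastNonempty (not from the cyclic
  -- wrap-around to N-1), so it is filled and only gaps lie between p and q.
  prev-spec : ∀ {j q p} → suc p < N → prev j q ≡ p →
              p < q × IsSuffix j p × (∀ c → p < c → c < q → cell j c ≡ nothing)
  prev-spec {j} {q} p+1<N prev≡ with lastNonempty j q in e
  ... | just p′ with prev≡
  ...   | refl = lastNonempty-spec j q e
  prev-spec {j} {q} p+1<N refl | nothing = ⊥-elim (wrap-around N p+1<N)
    where
    wrap-around : ∀ n → suc (n ∸ 1) < n → ⊥
    wrap-around (suc n) (s≤s n<n) = n≮n n n<n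

  prev-filled : ∀ {j q p} → suc p < N → prev j q ≡ p → IsSuffix j p
  prev-filled {j} {q} p+1<N prev≡ = proj₁ (proj₂ (prev-spec {j} {q} p+1<N prev≡))

  prev-exact : ∀ {j q p} → suc p < N → prev j q ≡ p → IsSuffix j (suc p) → q ≡ suc p
  prev-exact {j} {q} p+1<N prev≡ (_ , filled) with prev-spec {j} {q} p+1<N prev≡
  ... | p<q , _ , gaps with m≤n⇒m<n∨m≡n p<q
  ...   | inj₂ p+1≡q = sym p+1≡q
  ...   | inj₁ p+1<q with trans (sym (gaps _ ≤-refl p+1<q)) filled
  ...     | ()

  -- Rows agree on the preceding character at column 0 (cyclically the last, a cs-column)
  -- and after a cs-column.
  precChar-at-zero : ∀ j j′ → precChar j 0 ≡ precChar j′ 0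
  precChar-at-zero j j′ with cs-cells last-column-cs
  ... | c , cells = trans (cells j) (sym (cells j′))

  precChar-after-cs : ∀ {q} j j′ → tag q ≡ just cs → precChar j (suc q) ≡ precChar j′ (suc q)
  precChar-after-cs j j′ t with cs-cells t
  ... | c , cells = trans (precChar-after-filled (cells j)) (sym (precChar-after-filled (cells j′)))

  gap-before-gap : ∀ {j q i} → tag q ≡ just (ps i) → tag (suc q) ≡ just (ps i) →
                   cell j (suc q) ≡ nothing → cell j q ≡ nothing
  gap-before-gap {j} {q} t t′ gap with cell j q in e
  ... | nothing = refl
  ... | just _ with trans (sym gap) (proj₂ (filled-next t t′ e))
  ...   | ()

  -- Two rows with a gap in the same ps-column agree on the preceding character: both
  -- are empty back to the start of the region and read the same cs-column before it.
  precChar-in-gaps : ∀ {q i} j j′ → tag q ≡ just (ps i) → cell j q ≡ nothing → cell j′ q ≡ nothing →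
                     precChar j (suc q) ≡ precChar j′ (suc q)
  precChar-in-gaps {q} j j′ t gap gap′ =
    trans (precChar-after-gap gap) (trans (earlier q t gap gap′) (sym (precChar-after-gap gap′)))
    where
    earlier : ∀ q {i} → tag q ≡ just (ps i) → cell j q ≡ nothing → cell j′ q ≡ nothing →
              precChar j q ≡ precChar j′ q
    earlier zero    _ _   _    = precChar-at-zero j j′
    earlier (suc q) t gap gap′ with column-kind (<-trans (n<1+n q) (tag-bound t))
    ... | inj₁ t-cs = precChar-after-cs j j′ t-cs
    ... | inj₂ (_ , t-ps) with same-region t-ps t
    ...   | refl = precChar-in-gaps j j′ t-ps (gap-before-gap t-ps t gap) (gap-before-gap t-ps t gap′)

  next-filled : ∀ {j q i} → tag q ≡ just (ps i) → suc q < N → IsSuffix j q → IsSuffix j (suc q)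
  next-filled {j} t q+1<N (_ , filled) with column-kind q+1<N
  ... | inj₁ t-cs = proj₁ (cs-cells t-cs) , proj₂ (cs-cells t-cs) j
  ... | inj₂ (_ , t-ps) with same-region t t-ps
  ...   | refl = filled-next t t-ps filled

  next-same-class : ∀ {j j′ q i} → tag q ≡ just (ps i) → suc q < N → SameClassAt q j j′ → SameClassAt (suc q) j j′
  next-same-class {j} {j′} t q+1<N same with column-kind q+1<N
  ... | inj₁ t-cs = cs-same-class t-cs
  ... | inj₂ (_ , t-ps) with same-region t t-ps
  ...   | refl = ps-same-class t-ps
                   (∷-injectiveʳ (trans (sym (δ-step j t)) (trans (same-class-ps t same) (δ-step j′ t))))

  -- Case: row j₁ is filled in the ps-column q before q₁ = q+1.  The predecessors of
  -- (j₁,q+1) and (j₂,q₂) lie in column q with equal region contents; hence q₂ = q+1 and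
  -- (j₂,q₂) lies in the a-suffix of (j₁,q+1).
  filled-predecessor : ∀ {i j₁ j₂ q q₂ c} → tag q ≡ just (ps i) → cell j₁ q ≡ just c → IsSuffix j₁ (suc q) →
                       SameA (j₁ , prev j₁ (suc q)) (j₂ , prev j₂ q₂) → SameA (j₁ , suc q) (j₂ , q₂)
  filled-predecessor {j₁ = j₁} {j₂} {q₂ = q₂} t filled s₁ (prev≡ , same-prev) =
    sym (prev-exact {q = q₂} q+1<N prev₂ (next-filled t q+1<N (prev-filled {q = q₂} q+1<N prev₂))) ,
    next-same-class t q+1<N (subst (λ p → SameClassAt p j₁ j₂) (prev-after-filled filled) same-prev)
    where
    q+1<N = suffix-bound s₁
    prev₂ = trans (sym prev≡) (prev-after-filled filled)

  -- Case: row j₁ has a gap in the ps-column q before q₁ = q+1.  Then row j₁ holds all of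
  -- α̃⁺_iΔ^{j₁}_i from q+1 on; row j, having the same content there, cannot be filled at q
  -- (content-not-extended), so both rows have a gap at q.
  empty-predecessor : ∀ {i j j₁ q} → tag q ≡ just (ps i) → cell j₁ q ≡ nothing → IsSuffix j₁ (suc q) →
                      SameClassAt (suc q) j j₁ → precChar j (suc q) ≡ precChar j₁ (suc q)
  empty-predecessor t gap₁ _ _ with proj₁ (ps-facts t)
  empty-predecessor t gap₁ _ _ | inj₂ t-cs with trans (sym gap₁) (proj₂ (region-end-filled t t-cs))
  ... | ()
  empty-predecessor {i} {j} {j₁} {q} t gap₁ (_ , filled₁) same | inj₁ t-ps with cell-cases j q
  ... | inj₂ e = precChar-in-gaps j j₁ t e gap₁
  ... | inj₁ (a , e) with content-before t e (trans (same-class-ps t-ps same) (content-after-gap t t-ps gap₁ filled₁))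
  ...   | Y , extended = ⊥-elim (content-not-extended j j₁ i Y a extended)

  precChar-shared : ∀ {j₁ j₂ q₁ q₂ j} → IsSuffix j₁ q₁ → ¬ SameA (j₁ , q₁) (j₂ , q₂) →
                    SameA (j₁ , prev j₁ q₁) (j₂ , prev j₂ q₂) → SameClassAt q₁ j j₁ →
                    precChar j q₁ ≡ precChar j₁ q₁
  precChar-shared {j₁} {q₁ = zero} {j = j} _ _ _ _ = precChar-at-zero j j₁
  precChar-shared {j₁} {q₁ = suc q} {j = j} s₁ distinct same-prev same
    with column-kind (<-trans (n<1+n q) (suffix-bound s₁))
  ... | inj₁ t-cs = precChar-after-cs j j₁ t-cs
  ... | inj₂ (_ , t-ps) with cell-cases j₁ q
  ...   | inj₁ (_ , e) = ⊥-elim (distinct (filled-predecessor t-ps e s₁ same-prev))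
  ...   | inj₂ e       = empty-predecessor t-ps e s₁ same

-- (j₁,q₁) and (j₂,q₂) witness that (σ,i) is of (m:1)-type, where SAA[i] is the a-suffix
-- of (j₁,q₁); every suffix (j,q) of SAA[i] is preceded by σ.
lemma2 : (I : Setting) → let open Alignment I in
    (σ : C) (j₁ j₂ : Fin m) (q₁ q₂ : ℕ) →
    IsSuffix j₁ q₁ → IsSuffix j₂ q₂ →
    precChar j₁ q₁ ≡ just σ → precChar j₂ q₂ ≡ just σ →
    ¬ SameA (j₁ , q₁) (j₂ , q₂) →
    SameA (j₁ , prev j₁ q₁) (j₂ , prev j₂ q₂) →
    (j : Fin m) (q : ℕ) → IsSuffix j q → SameA (j , q) (j₁ , q₁) →
    precChar j q ≡ just σ
lemma2 I σ j₁ j₂ q₁ q₂ s₁ _ σ-before₁ _ distinct same-prev j q _ (refl , same) =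
  trans (Columns.precChar-shared I s₁ distinct same-prev same) σ-before₁
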